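{- Let $t,s,c,\sigma,\gamma$ be positive integers with $c>\gamma$. Then the optimal number of dinners $r(t,s,c,\sigma,\gamma)$ of the Business Dinner Problem satisfies $$r\geq\left\lceil\frac{\sqrt{s}}{t\gamma}\left((c-\gamma)\max\left(\sqrt{\frac{\gamma}{c-\gamma}},1\right)+\frac{\gamma}{\max\left(\sqrt{\frac{\gamma}{c-\gamma}},1\right)}\right)\right\rceil.$$
   Context: Business Dinner Problem: given positive integers $t$ (number of tables), $s$ (suppliers), $c$ (customers), $\sigma$ and $\gamma$. A schedule is a finite sequence of dinners; in each dinner, each participant (supplier or customer) sits at at most one of the $t$ tables (participants may be absent from a dinner), and each table hosts at most $\sigma$ suppliers and at most $\gamma$ customers. The schedule is feasible if (i) any two distinct suppliers sit at the same table in at most one dinner, and (ii) every customer and every supplier sit at the same table in exactly one dinner. $r(t,s,c,\sigma,\gamma)$ is the minimum number of dinners of a feasible schedule. -}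

module Defs where

open import Data.Nat using (ℕ; _+_; _*_; _∸_; _≤_; _<_)
open import Data.Fin using (Fin; _≟_)
open import Data.Maybe using (Maybe; just)
open import Data.Maybe.Properties using (≡-dec)
open import Data.List using (length; filter)
open import Data.List.Base using ()
open import Data.Fin.Base using ()
open import Data.List using (List)
open import Data.Product using (Σ; ∃; _×_)
open import Relation.Binary.PropositionalEquality using (_≡_; _≢_)

open import Data.List.Base using () renaming (tabulate to tabulateL)

allFin' : (n : ℕ) → List (Fin n)
allFin' n = tabulateL (λ i → i)

-- One dinner: each supplier / customer sits at at most one of the t tables
-- (nothing = absent from this dinner).
record Dinner (t s c : ℕ) : Set where
  field
    supSeat  : Fin s → Maybe (Fin t)
    custSeat : Fin c → Maybe (Fin t)
open Dinner public

Schedule : (t s c n : ℕ) → Set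
Schedule t s c n = Fin n → Dinner t s c

#at : {t m : ℕ} → (Fin m → Maybe (Fin t)) → Fin t → ℕ
#at {t} {m} seat T = length (filter (λ i → ≡-dec _≟_ (seat i) (just T)) (allFin' m))

Capacity : {t s c : ℕ} → (σ γ : ℕ) → Dinner t s c → Set
Capacity σ γ D = ∀ T → #at (supSeat D) T ≤ σ × #at (custSeat D) T ≤ γ

SameTable : {t : ℕ} → Maybe (Fin t) → Maybe (Fin t) → Set
SameTable {t} x y = Σ (Fin t) λ T → x ≡ just T × y ≡ just T

Feasible : {t s c n : ℕ} → (σ γ : ℕ) → Schedule t s c n → Set
Feasible {t} {s} {c} {n} σ γ S =
    (∀ k → Capacity σ γ (S k))
  × (∀ (i j : Fin s) → i ≢ j → ∀ (k k' : Fin n) →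
       SameTable (supSeat (S k) i) (supSeat (S k) j) →
       SameTable (supSeat (S k') i) (supSeat (S k') j) → k ≡ k')
  × (∀ (u : Fin c) (i : Fin s) →
       ∃ λ k → SameTable (custSeat (S k) u) (supSeat (S k) i)
             × (∀ k' → SameTable (custSeat (S k') u) (supSeat (S k') i) → k' ≡ k))

-- n ≥ ⌈ (√s/(tγ)) ((c-γ) m + γ/m) ⌉ with m = max(√(γ/(c-γ)), 1), c > γ,
-- rewritten without reals (n integer, all quantities nonnegative):
--   if γ ≤ c-γ : m = 1, bound = √s c/(tγ)      ⇔ s c² ≤ (n t γ)²
--   if γ > c-γ : m = √(γ/(c-γ)), bound = 2√s √(γ(c-γ))/(tγ) ⇔ 4 s γ (c-γ) ≤ (n t γ)²
DinnerLowerBound : (t s c γ n : ℕ) → Set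
DinnerLowerBound t s c γ n =
    (γ ≤ c ∸ γ → s * (c * c) ≤ (n * t * γ) * (n * t * γ))
  × (c ∸ γ < γ → 4 * s * γ * (c ∸ γ) ≤ (n * t * γ) * (n * t * γ))

{-# OPTIONS --safe #-}
-- Let u be a customer attending the fewest dinners, p of them, and let k be a
-- dinner at which u meets the largest number a of suppliers, at table τ, so that
-- s ≤ p a.  A customer who is not at τ in dinner k meets those a suppliers at a
-- distinct dinners, while each of the at most γ customers at τ attends at least
-- p dinners.  Double counting seats bounds the total attendance X by n t γ,
-- so c p ≤ X, and (c − γ) a + γ p ≤ X when p ≤ a.  Eliminating p and a,
-- according as p² ≥ s or p² ≤ s, leaves s c² ≤ X² when γ ≤ c − γ and
-- 4 s γ (c − γ) ≤ X² in any case.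
module Submission where

open import Defs
open import Level using (Level)
open import Function using (id; _∘_)
open import Data.Bool using (true; false; if_then_else_)
open import Data.Nat using (ℕ; zero; suc; _+_; _*_; _∸_; _≤_; _<_; z≤n; s≤s; NonZero; >-nonZero)
open import Data.Nat.Properties hiding (_≟_)
open import Data.Nat.Tactic.RingSolver using (solve-∀)
open import Data.Fin using (Fin; zero; suc; _≟_; fromℕ<)
import Data.Fin.Properties as Fin
open import Data.List using (length; filter; tabulate; allFin)
open import Data.List.Extrema.Nat using (argmin; argmax; f[argmin]≤f[xs]; f[xs]≤f[argmax])
open import Data.List.Membership.Propositional.Properties using (∈-allFin)
import Data.List.Relation.Unary.All as All
open import Data.Maybe using (Maybe; just)
open import Data.Maybe.Properties using (≡-dec; just-injective)
open import Data.Product as Product using (∃; ∃-syntax; _×_; _,_; proj₁; proj₂)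
open import Data.Sum using (inj₁; inj₂; [_,_]′)
open import Relation.Nullary using (Dec; yes; no; does; ¬_; contradiction; _×-dec_)
open import Data.Unit using (tt)
open import Relation.Unary using (Pred; Decidable)
open import Relation.Binary.Definitions using (DecidableEquality)
open import Relation.Binary.PropositionalEquality
open import Algebra.Properties.Semiring.Sum +-*-semiring
  using (sum; sum-syntax; sum-cong-≗; sum-replicate-zero; ∑-comm; ∑-distrib-+; *-distribʳ-sum)

private
  variable
    ℓ : Level
    A : Set
    m n t x : ℕ

𝟙 : {P : Set ℓ} → Dec P → ℕ
𝟙 P? = if does P? then 1 else 0

count : {P : Pred (Fin n) ℓ} → Decidable P → ℕ
count {n = n} P? = ∑[ i < n ] 𝟙 (P? i)

∑-const : ∀ n x → ∑[ i < n ] x ≡ n * x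
∑-const zero    x = refl
∑-const (suc n) x = cong (x +_) (∑-const n x)

∑-mono-≤ : {f g : Fin n → ℕ} → (∀ i → f i ≤ g i) → sum f ≤ sum g
∑-mono-≤ {n = zero}  _   = z≤n
∑-mono-≤ {n = suc n} f≤g = +-mono-≤ (f≤g zero) (∑-mono-≤ (f≤g ∘ suc))

length-filter-tabulate : {P : Pred A ℓ} (P? : Decidable P) (f : Fin n → A) →
                         length (filter P? (tabulate f)) ≡ count (P? ∘ f)
length-filter-tabulate {n = zero}  P? f = refl
length-filter-tabulate {n = suc n} P? f with does (P? (f zero))
... | true  = cong suc (length-filter-tabulate P? (f ∘ suc))
... | false = length-filter-tabulate P? (f ∘ suc)

count-≡0 : {P : Pred (Fin n) ℓ} (P? : Decidable P) → (∀ {i} → ¬ P i) → count P? ≡ 0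
count-≡0 {n = n} P? ¬P = trans (sum-cong-≗ 𝟙≡0) (sum-replicate-zero n)
  where
  𝟙≡0 : ∀ i → 𝟙 (P? i) ≡ 0
  𝟙≡0 i with P? i
  ... | yes Pᵢ = contradiction Pᵢ ¬P
  ... | no  _  = refl

count-≤ : {P : Pred (Fin n) ℓ} (P? : Decidable P) →
          (∀ {i j} → P i → P j → i ≡ j) → (∀ {i} → P i → 1 ≤ x) → count P? ≤ x
count-≤ {n = zero}  _  _      _   = z≤n
count-≤ {n = suc n} P? unique 1≤x with P? zero
... | yes P₀ = ≤-trans (≤-reflexive (cong suc rest≡0)) (1≤x P₀)
  where
  rest≡0 : count (P? ∘ suc) ≡ 0
  rest≡0 = count-≡0 (P? ∘ suc) (λ Pᵢ → Fin.0≢1+n (unique P₀ Pᵢ))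
... | no  _  = count-≤ (P? ∘ suc) (λ Pᵢ Pⱼ → Fin.suc-injective (unique Pᵢ Pⱼ)) 1≤x

1≤count : {P : Pred (Fin n) ℓ} (P? : Decidable P) {i : Fin n} → P i → 1 ≤ count P?
1≤count P? {zero} P₀ with P? zero
... | yes _   = s≤s z≤n
... | no  ¬P₀ = contradiction P₀ ¬P₀
1≤count P? {suc i} Pᵢ = ≤-trans (1≤count (P? ∘ suc) Pᵢ) (m≤n+m _ _)

count-witness : {P : Pred (Fin n) ℓ} (P? : Decidable P) → 1 ≤ count P? → ∃ P
count-witness {n = suc n} P? 1≤count with P? zero
... | yes P₀ = zero , P₀
... | no  _  = let i , Pᵢ = count-witness (P? ∘ suc) 1≤count in suc i , Pᵢ

count-≡1 : {P : Pred (Fin n) ℓ} (P? : Decidable P) {i : Fin n} →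
           P i → (∀ {j} → P j → j ≡ i) → count P? ≡ 1
count-≡1 P? Pᵢ only-i =
  ≤-antisym (count-≤ P? (λ Pⱼ Pₖ → trans (only-i Pⱼ) (sym (only-i Pₖ))) (λ _ → ≤-refl))
            (1≤count P? Pᵢ)

count-fibres : {P : Pred (Fin m) ℓ} (P? : Decidable P) (f : Fin m → Fin n) →
               count P? ≡ ∑[ k < n ] count (λ i → P? i ×-dec f i ≟ k)
count-fibres {m = m} {n = n} P? f = begin
  ∑[ i < m ] 𝟙 (P? i)                           ≡⟨ sum-cong-≗ fibre-count ⟩
  ∑[ i < m ] ∑[ k < n ] 𝟙 (P? i ×-dec f i ≟ k)  ≡⟨ ∑-comm (λ i k → 𝟙 (P? i ×-dec f i ≟ k)) ⟩
  ∑[ k < n ] ∑[ i < m ] 𝟙 (P? i ×-dec f i ≟ k)  ∎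
  where
  open ≡-Reasoning
  fibre-count : ∀ i → 𝟙 (P? i) ≡ count (λ k → P? i ×-dec f i ≟ k)
  fibre-count i with P? i
  ... | yes Pᵢ = sym (count-≡1 (λ k → yes Pᵢ ×-dec f i ≟ k) (Pᵢ , refl) (λ (_ , fᵢ≡k) → sym fᵢ≡k))
  ... | no ¬Pᵢ = sym (count-≡0 (λ k → no ¬Pᵢ ×-dec f i ≟ k) (λ (Pᵢ , _) → ¬Pᵢ Pᵢ))

-- For the always-true predicate, `yes tt ×-dec d` computes to `d`.
∑-count-fibres : (f : Fin m → Fin n) → ∑[ k < n ] count (λ i → f i ≟ k) ≡ m
∑-count-fibres {m = m} {n = n} f = begin
  ∑[ k < n ] count (λ i → f i ≟ k)  ≡⟨ count-fibres (λ _ → yes tt) f ⟨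
  ∑[ i < m ] 1                      ≡⟨ ∑-const m 1 ⟩
  m * 1                             ≡⟨ *-identityʳ m ⟩
  m                                 ∎
  where open ≡-Reasoning

count≤∑-injection : {P : Pred (Fin m) ℓ} (P? : Decidable P) (f : Fin m → Fin n) (w : Fin n → ℕ) →
                    (∀ {i} → P i → 1 ≤ w (f i)) → (∀ {i j} → P i → P j → f i ≡ f j → i ≡ j) →
                    count P? ≤ ∑[ k < n ] w k
count≤∑-injection {n = n} P? f w 1≤w injective = begin
  count P?                                     ≡⟨ count-fibres P? f ⟩
  ∑[ k < n ] count (λ i → P? i ×-dec f i ≟ k)  ≤⟨ ∑-mono-≤ fibre≤w ⟩
  ∑[ k < n ] w k                               ∎
  where
  open ≤-Reasoning
  fibre≤w : ∀ k → count (λ i → P? i ×-dec f i ≟ k) ≤ w k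
  fibre≤w k = count-≤ (λ i → P? i ×-dec f i ≟ k)
    (λ (Pᵢ , fᵢ≡k) (Pⱼ , fⱼ≡k) → injective Pᵢ Pⱼ (trans fᵢ≡k (sym fⱼ≡k)))
    (λ { (Pᵢ , refl) → 1≤w Pᵢ })

∃-argmin : (f : Fin n → ℕ) → Fin n → ∃[ k ] ∀ j → f k ≤ f j
∃-argmin f k₀ = argmin f k₀ (allFin _) , λ j → All.lookup (f[argmin]≤f[xs] k₀ (allFin _)) (∈-allFin j)

∃-argmax : (f : Fin n → ℕ) → Fin n → ∃[ k ] ∀ j → f j ≤ f k
∃-argmax f k₀ = argmax f k₀ (allFin _) , λ j → All.lookup (f[xs]≤f[argmax] k₀ (allFin _)) (∈-allFin j)

4xy≤[x+y]² : ∀ x y → 4 * x * y ≤ (x + y) * (x + y)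
4xy≤[x+y]² x y = [ ordered , (λ y≤x → subst₂ _≤_ (swap-4xy y x) (swap-square y x) (ordered y≤x)) ]′
                   (≤-total x y)
  where
  swap-4xy : ∀ x y → 4 * x * y ≡ 4 * y * x
  swap-4xy = solve-∀
  swap-square : ∀ x y → (x + y) * (x + y) ≡ (y + x) * (y + x)
  swap-square = solve-∀
  ordered : ∀ {x y} → x ≤ y → 4 * x * y ≤ (x + y) * (x + y)
  ordered {x} {y} x≤y with y ∸ x | m+[n∸m]≡n x≤y
  ... | d | refl = begin
    4 * x * (x + d)                ≤⟨ m≤m+n _ (d * d) ⟩
    4 * x * (x + d) + d * d        ≡⟨ expand x d ⟩
    (x + (x + d)) * (x + (x + d))  ∎
    where
    open ≤-Reasoning
    expand : ∀ x d → 4 * x * (x + d) + d * d ≡ (x + (x + d)) * (x + (x + d))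
    expand = solve-∀

-- (e s + γ q)² − s q (γ + e)² = (s − q)(e² s − γ² q).
sq[γ+e]²≤[es+γq]² : ∀ {γ e q s} → γ ≤ e → q ≤ s →
                    s * ((γ + e) * (γ + e)) * q ≤ (e * s + γ * q) * (e * s + γ * q)
sq[γ+e]²≤[es+γq]² {γ} {e} {q} {s} γ≤e q≤s with e ∸ γ | m+[n∸m]≡n γ≤e | s ∸ q | m+[n∸m]≡n q≤s
... | f | refl | d | refl = begin
  (q + d) * ((γ + (γ + f)) * (γ + (γ + f))) * q                            ≤⟨ m≤m+n _ _ ⟩
  (q + d) * ((γ + (γ + f)) * (γ + (γ + f))) * q
    + ((2 * γ + f) * f * q * d + (γ + f) * (γ + f) * d * d)                 ≡⟨ expand γ f q d ⟩
  ((γ + f) * (q + d) + γ * q) * ((γ + f) * (q + d) + γ * q)                ∎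
  where
  open ≤-Reasoning
  expand : ∀ γ f q d →
    (q + d) * ((γ + (γ + f)) * (γ + (γ + f))) * q
      + ((2 * γ + f) * f * q * d + (γ + f) * (γ + f) * d * d)
    ≡ ((γ + f) * (q + d) + γ * q) * ((γ + f) * (q + d) + γ * q)
  expand = solve-∀

-- Split on p ≥ √s or p ≤ √s; in the second case p ≤ a, and multiplying
-- e a + γ p ≤ X by p gives e s + γ p² ≤ X p.
square-bounds : ∀ {s c γ e p a X} → c ≡ γ + e → 1 ≤ s → s ≤ p * a → c * p ≤ X →
                (p ≤ a → e * a + γ * p ≤ X) →
                (γ ≤ e → s * (c * c) ≤ X * X) × (4 * s * γ * e ≤ X * X)
square-bounds {s} {c} {γ} {e} {p} {a} {X} refl 1≤s s≤pa cp≤X ea+γp≤X with ≤-total s (p * p)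
... | inj₁ s≤p² = (λ _ → sc²≤X²) , ≤-trans 4sγe≤sc² sc²≤X²
  where
  open ≤-Reasoning
  sc²≤X² : s * (c * c) ≤ X * X
  sc²≤X² = begin
    s * (c * c)      ≤⟨ *-monoˡ-≤ (c * c) s≤p² ⟩
    p * p * (c * c)  ≡⟨ regroup p c ⟩
    c * p * (c * p)  ≤⟨ *-mono-≤ cp≤X cp≤X ⟩
    X * X            ∎
    where
    regroup : ∀ p c → p * p * (c * c) ≡ c * p * (c * p)
    regroup = solve-∀
  4sγe≤sc² : 4 * s * γ * e ≤ s * (c * c)
  4sγe≤sc² = begin
    4 * s * γ * e    ≡⟨ regroup s γ e ⟩
    s * (4 * γ * e)  ≤⟨ *-monoʳ-≤ s (4xy≤[x+y]² γ e) ⟩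
    s * (c * c)      ∎
    where
    regroup : ∀ s γ e → 4 * s * γ * e ≡ s * (4 * γ * e)
    regroup = solve-∀
... | inj₂ p²≤s = (λ γ≤e → cancel (≤-trans (sq[γ+e]²≤[es+γq]² γ≤e p²≤s) Y²≤X²p²)) , cancel 4sγep²≤X²p²
  where
  open ≤-Reasoning
  instance
    p≢0 : NonZero p
    p≢0 = m*n≢0⇒m≢0 p {{>-nonZero (≤-trans 1≤s s≤pa)}}
    p²≢0 : NonZero (p * p)
    p²≢0 = m*n≢0 p p
  Y : ℕ
  Y = e * s + γ * (p * p)
  Y≤Xp : Y ≤ X * p
  Y≤Xp = begin
    e * s + γ * (p * p)        ≤⟨ +-monoˡ-≤ (γ * (p * p)) (*-monoʳ-≤ e s≤pa) ⟩
    e * (p * a) + γ * (p * p)  ≡⟨ regroup e p a γ ⟩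
    (e * a + γ * p) * p        ≤⟨ *-monoˡ-≤ p (ea+γp≤X (*-cancelˡ-≤ p (≤-trans p²≤s s≤pa))) ⟩
    X * p                      ∎
    where
    regroup : ∀ e p a γ → e * (p * a) + γ * (p * p) ≡ (e * a + γ * p) * p
    regroup = solve-∀
  Y²≤X²p² : Y * Y ≤ X * X * (p * p)
  Y²≤X²p² = begin
    Y * Y            ≤⟨ *-mono-≤ Y≤Xp Y≤Xp ⟩
    X * p * (X * p)  ≡⟨ regroup X p ⟩
    X * X * (p * p)  ∎
    where
    regroup : ∀ X p → X * p * (X * p) ≡ X * X * (p * p)
    regroup = solve-∀
  4sγep²≤X²p² : 4 * s * γ * e * (p * p) ≤ X * X * (p * p)
  4sγep²≤X²p² = begin
    4 * s * γ * e * (p * p)      ≡⟨ regroup s γ e (p * p) ⟩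
    4 * (e * s) * (γ * (p * p))  ≤⟨ 4xy≤[x+y]² (e * s) (γ * (p * p)) ⟩
    Y * Y                        ≤⟨ Y²≤X²p² ⟩
    X * X * (p * p)              ∎
    where
    regroup : ∀ s γ e q → 4 * s * γ * e * q ≡ 4 * (e * s) * (γ * q)
    regroup = solve-∀
  cancel : ∀ {y} → y * (p * p) ≤ X * X * (p * p) → y ≤ X * X
  cancel = *-cancelʳ-≤ _ _ (p * p)

ca+gp≤X+ga⇒ea+γp≤X : ∀ {c γ e a p g X} → c ≡ γ + e → g ≤ γ → p ≤ a →
                      c * a + g * p ≤ X + g * a → e * a + γ * p ≤ X
ca+gp≤X+ga⇒ea+γp≤X {γ = γ} {e} {a} {p} {g} {X} refl g≤γ p≤a ca+gp≤X+ga
  with γ ∸ g | m+[n∸m]≡n g≤γ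
... | h | refl = +-cancelʳ-≤ ((g + h) * a) _ _ (begin
  e * a + (g + h) * p + (g + h) * a  ≡⟨ regroup₁ e a p g h ⟩
  (g + h + e) * a + g * p + h * p    ≤⟨ +-mono-≤ ca+gp≤X+ga (*-monoʳ-≤ h p≤a) ⟩
  X + g * a + h * a                  ≡⟨ regroup₂ X g a h ⟩
  X + (g + h) * a                    ∎)
  where
  open ≤-Reasoning
  regroup₁ : ∀ e a p g h → e * a + (g + h) * p + (g + h) * a ≡ (g + h + e) * a + g * p + h * p
  regroup₁ = solve-∀
  regroup₂ : ∀ X g a h → X + g * a + h * a ≡ X + (g + h) * a
  regroup₂ = solve-∀

-- X is the total attendance, p the least attendance of a customer u, a the
-- largest number of suppliers u meets at one dinner, and g the number of
-- customers at u's table there.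
record CountingBounds (s c γ X : ℕ) : Set where
  field
    p a g      : ℕ
    s≤pa       : s ≤ p * a
    cp≤X       : c * p ≤ X
    ca+gp≤X+ga : c * a + g * p ≤ X + g * a
    g≤γ        : g ≤ γ

countingBounds⇒lowerBound : ∀ {t s c γ n X} → 1 ≤ s → γ < c → CountingBounds s c γ X →
                            X ≤ n * t * γ → DinnerLowerBound t s c γ n
countingBounds⇒lowerBound {t} {s} {c} {γ} {n} {X} 1≤s γ<c bounds X≤N =
  Product.map (λ bound γ≤e → ≤-trans (bound γ≤e) X²≤N²) (λ bound _ → ≤-trans bound X²≤N²)
    (square-bounds c≡γ+e 1≤s s≤pa cp≤X (λ p≤a → ca+gp≤X+ga⇒ea+γp≤X c≡γ+e g≤γ p≤a ca+gp≤X+ga))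
  where
  open CountingBounds bounds
  c≡γ+e : c ≡ γ + (c ∸ γ)
  c≡γ+e = sym (m+[n∸m]≡n (<⇒≤ γ<c))
  X²≤N² : X * X ≤ n * t * γ * (n * t * γ)
  X²≤N² = *-mono-≤ X≤N X≤N

SameTable-sym : {x y : Maybe (Fin t)} → SameTable x y → SameTable y x
SameTable-sym (T , x≡T , y≡T) = T , y≡T , x≡T

SameTable-trans : {x y z : Maybe (Fin t)} → SameTable x y → SameTable y z → SameTable x z
SameTable-trans (T , x≡T , y≡T) (T′ , y≡T′ , z≡T′) with just-injective (trans (sym y≡T) y≡T′)
... | refl = T , x≡T , z≡T′

_≟ₘ_ : DecidableEquality (Maybe (Fin t))
_≟ₘ_ = ≡-dec _≟_

-- Counting tables rather than testing for `just` makes the total attendance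
-- below a rearrangement of the table occupancies `#at`.
seatings : Maybe (Fin t) → ℕ
seatings x = count (λ T → x ≟ₘ just T)

#at≡count : (seat : Fin m → Maybe (Fin t)) (T : Fin t) → #at seat T ≡ count (λ v → seat v ≟ₘ just T)
#at≡count seat T = length-filter-tabulate (λ v → seat v ≟ₘ just T) id

module _ {t s c n : ℕ} (S : Schedule t s c n) where

  attendance : Fin c → ℕ
  attendance v = ∑[ k < n ] seatings (custSeat (S k) v)

  ∑-attendance≤ : ∀ {σ γ} → (∀ k → Capacity σ γ (S k)) → ∑[ v < c ] attendance v ≤ n * t * γ
  ∑-attendance≤ {γ = γ} capacity = begin
    ∑[ v < c ] ∑[ k < n ] ∑[ T < t ] 𝟙 (seat k v T)  ≡⟨ ∑-comm (λ v k → ∑[ T < t ] 𝟙 (seat k v T)) ⟩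
    ∑[ k < n ] ∑[ v < c ] ∑[ T < t ] 𝟙 (seat k v T)  ≡⟨ sum-cong-≗ (λ k → ∑-comm (λ v T → 𝟙 (seat k v T))) ⟩
    ∑[ k < n ] ∑[ T < t ] count (λ v → seat k v T)    ≡⟨ sum-cong-≗ (λ k → sum-cong-≗ (#at≡count (custSeat (S k)))) ⟨
    ∑[ k < n ] ∑[ T < t ] #at (custSeat (S k)) T      ≤⟨ ∑-mono-≤ (λ k → ∑-mono-≤ (λ T → proj₂ (capacity k T))) ⟩
    ∑[ k < n ] ∑[ T < t ] γ                           ≡⟨ sum-cong-≗ {n} (λ k → ∑-const t γ) ⟩
    ∑[ k < n ] (t * γ)                                ≡⟨ ∑-const n (t * γ) ⟩
    n * (t * γ)                                       ≡⟨ *-assoc n t γ ⟨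
    n * t * γ                                         ∎
    where
    open ≤-Reasoning
    seat : ∀ k v T → Dec (custSeat (S k) v ≡ just T)
    seat k v T = custSeat (S k) v ≟ₘ just T

module _ {t s c n σ γ : ℕ} {S : Schedule t s c n} (F : Feasible σ γ S) where

  private
    cust : Fin n → Fin c → Maybe (Fin t)
    cust k v = custSeat (S k) v
    sup : Fin n → Fin s → Maybe (Fin t)
    sup k i = supSeat (S k) i

  suppliers-meet-once : ∀ i j → i ≢ j → ∀ k k′ →
    SameTable (sup k i) (sup k j) → SameTable (sup k′ i) (sup k′ j) → k ≡ k′
  suppliers-meet-once = proj₁ (proj₂ F)

  -- Only the existence half of condition (ii) is needed.
  meeting : Fin c → Fin s → Fin n
  meeting v i = proj₁ (proj₂ (proj₂ F) v i)

  meets-at : ∀ {v i k} → meeting v i ≡ k → SameTable (cust k v) (sup k i)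
  meets-at {v} {i} refl = proj₁ (proj₂ (proj₂ (proj₂ F) v i))

  metAt : Fin c → Fin n → ℕ
  metAt u k = count (λ i → meeting u i ≟ k)

  seated-at-meeting : ∀ {v i k} → meeting v i ≡ k → 1 ≤ seatings (cust k v)
  seated-at-meeting {v} {k = k} met with meets-at met
  ... | T , v≡T , _ = 1≤count (λ T → cust k v ≟ₘ just T) v≡T

  s≤attendance*max : ∀ u {a} → (∀ k → metAt u k ≤ a) → s ≤ attendance S u * a
  s≤attendance*max u {a} metAt≤a = begin
    s                                     ≡⟨ ∑-count-fibres (meeting u) ⟨
    ∑[ k < n ] metAt u k                  ≤⟨ ∑-mono-≤ bound ⟩
    ∑[ k < n ] (seatings (cust k u) * a)  ≡⟨ *-distribʳ-sum a (λ k → seatings (cust k u)) ⟨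
    attendance S u * a                    ∎
    where
    open ≤-Reasoning
    bound : ∀ k → metAt u k ≤ seatings (cust k u) * a
    bound k with seatings (cust k u) in absent
    ... | zero  = ≤-reflexive (count-≡0 (λ i → meeting u i ≟ k)
                    (λ met → contradiction (subst (1 ≤_) absent (seated-at-meeting met)) λ ()))
    ... | suc _ = ≤-trans (metAt≤a k) (m≤m+n a _)

  -- Two suppliers met by u at dinner k and by v at a common dinner k′ share a
  -- table at k and at k′, so k′ = k and v sits at u's table.
  metAt≤attendance : ∀ {u v k} → ¬ SameTable (cust k u) (cust k v) → metAt u k ≤ attendance S v
  metAt≤attendance {u} {v} {k} apart =
    count≤∑-injection (λ i → meeting u i ≟ k) (meeting v) (λ k′ → seatings (cust k′ v))
      (λ _ → seated-at-meeting refl) injective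
    where
    injective : ∀ {i j} → meeting u i ≡ k → meeting u j ≡ k → meeting v i ≡ meeting v j → i ≡ j
    injective {i} {j} ui≡k uj≡k vi≡vj with i ≟ j
    ... | yes i≡j = i≡j
    ... | no  i≢j =
      contradiction (SameTable-trans (meets-at ui≡k) (SameTable-sym (meets-at (sym k≡vi)))) apart
      where
      k≡vi : k ≡ meeting v i
      k≡vi = suppliers-meet-once i j i≢j k (meeting v i)
        (SameTable-trans (SameTable-sym (meets-at ui≡k)) (meets-at uj≡k))
        (SameTable-trans (SameTable-sym (meets-at refl)) (meets-at (sym vi≡vj)))

  module _ (u : Fin c) (minimal : ∀ v → attendance S u ≤ attendance S v)
           (k : Fin n) (maximal : ∀ k′ → metAt u k′ ≤ metAt u k)
           {τ : Fin t} (u≡τ : cust k u ≡ just τ) where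

    private
      p a : ℕ
      p = attendance S u
      a = metAt u k
      tablemate? : (v : Fin c) → Dec (cust k v ≡ just τ)
      tablemate? v = cust k v ≟ₘ just τ

    per-customer-bound : ∀ v → a + 𝟙 (tablemate? v) * p ≤ attendance S v + 𝟙 (tablemate? v) * a
    per-customer-bound v with tablemate? v
    ... | yes _   = begin
      a + 1 * p            ≡⟨ +-comm a (1 * p) ⟩
      1 * p + a            ≡⟨ cong (_+ a) (*-identityˡ p) ⟩
      p + a                ≤⟨ +-monoˡ-≤ a (minimal v) ⟩
      attendance S v + a   ≡⟨ cong (attendance S v +_) (*-identityˡ a) ⟨
      attendance S v + 1 * a ∎
      where open ≤-Reasoning
    ... | no  v≢τ = +-monoˡ-≤ 0 (metAt≤attendance apart)
      where
      apart : ¬ SameTable (cust k u) (cust k v)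
      apart (T , u≡T , v≡T) = v≢τ (trans v≡T (trans (sym u≡T) u≡τ))

    ca+gp≤X+ga : c * a + count tablemate? * p ≤ ∑[ v < c ] attendance S v + count tablemate? * a
    ca+gp≤X+ga = begin
      c * a + count tablemate? * p
        ≡⟨ cong₂ _+_ (∑-const c a) (sym (*-distribʳ-sum p (𝟙 ∘ tablemate?))) ⟨
      ∑[ v < c ] a + ∑[ v < c ] (𝟙 (tablemate? v) * p)
        ≡⟨ ∑-distrib-+ (λ _ → a) (λ v → 𝟙 (tablemate? v) * p) ⟨
      ∑[ v < c ] (a + 𝟙 (tablemate? v) * p)
        ≤⟨ ∑-mono-≤ per-customer-bound ⟩
      ∑[ v < c ] (attendance S v + 𝟙 (tablemate? v) * a)
        ≡⟨ ∑-distrib-+ (attendance S) (λ v → 𝟙 (tablemate? v) * a) ⟩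
      ∑[ v < c ] attendance S v + ∑[ v < c ] (𝟙 (tablemate? v) * a)
        ≡⟨ cong (∑[ v < c ] attendance S v +_) (*-distribʳ-sum a (𝟙 ∘ tablemate?)) ⟨
      ∑[ v < c ] attendance S v + count tablemate? * a
        ∎
      where open ≤-Reasoning

    extremal-countingBounds : CountingBounds s c γ (∑[ v < c ] attendance S v)
    extremal-countingBounds = record
      { p = p
      ; a = a
      ; g = count tablemate?
      ; s≤pa = s≤attendance*max u maximal
      ; cp≤X = ≤-trans (≤-reflexive (sym (∑-const c p))) (∑-mono-≤ minimal)
      ; ca+gp≤X+ga = ca+gp≤X+ga
      ; g≤γ = ≤-trans (≤-reflexive (sym (#at≡count (custSeat (S k)) τ))) (proj₂ (proj₁ F k τ))
      }

  countingBounds : 1 ≤ s → 1 ≤ c → CountingBounds s c γ (∑[ v < c ] attendance S v)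
  countingBounds 1≤s 1≤c =
    let u , minimal  = ∃-argmin (attendance S) (fromℕ< 1≤c)
        i₀           = fromℕ< 1≤s
        k , maximal  = ∃-argmax (metAt u) (meeting u i₀)
        1≤metAt      = ≤-trans (1≤count (λ i → meeting u i ≟ meeting u i₀) refl) (maximal (meeting u i₀))
        _ , met-at-k = count-witness (λ i → meeting u i ≟ k) 1≤metAt
        _ , u≡τ , _  = meets-at met-at-k
    in extremal-countingBounds u minimal k maximal u≡τ

proposition2p2 : (t s c σ γ : ℕ) → 1 ≤ t → 1 ≤ s → 1 ≤ c → 1 ≤ σ → 1 ≤ γ → γ < c →
    (n : ℕ) (S : Schedule t s c n) → Feasible σ γ S → DinnerLowerBound t s c γ n
proposition2p2 t s c σ γ _ 1≤s 1≤c _ _ γ<c n S F =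
  countingBounds⇒lowerBound {t = t} {n = n} 1≤s γ<c (countingBounds F 1≤s 1≤c) (∑-attendance≤ S (proj₁ F))
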